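{- Let $n$ and $d$ be positive integers such that $d\ge 2$ (and $d\le n/2$) and let $G=C_n(1,d)$. Then \[\gamma^{LD}(G)\ge \left\lceil \frac{3n}{10}\right\rceil,\quad \gamma^{ID}(G)\ge \left\lceil \frac{7n}{20}\right\rceil,\quad \gamma^{SID}(G)\ge\left\lceil\frac{n}{2}\right\rceil.\]
   Context: All graphs are simple and undirected. For a graph $G=(V,E)$ and $u\in V$, $N[u]=\{u\}\cup\{v: uv\in E\}$. A code is a nonempty $C\subseteq V$, and $I(C;u)=N[u]\cap C$. $C$ is dominating if $I(C;u)\neq\emptyset$ for all $u$; identifying if dominating and $I(C;u)\neq I(C;v)$ for all distinct $u,v\in V$; locating-dominating if dominating and $I(C;u)\neq I(C;v)$ for all distinct $u,v\in V\setminus C$; self-identifying if $I(C;u)\setminus I(C;v)\neq\emptyset$ for all distinct $u,v\in V$. For a finite graph $G$, $\gamma^{ID}(G)$, $\gamma^{LD}(G)$, $\gamma^{SID}(G)$ denote the minimum cardinality of an identifying, locating-dominating, self-identifying code in $G$, respectively. For positive integers $n$ and $d_1,\dots,d_k\le n/2$, the circulant graph $C_n(d_1,\dots,d_k)$ has vertex set $\mathbb{Z}_n$, and the open neighbourhood of $u$ is $\{u\pm d_1,\dots,u\pm d_k\}$ modulo $n$. -}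

module Defs where

open import Data.Nat using (ℕ; suc; _+_; _*_; _∸_; _≤_; NonZero)
open import Data.Nat.DivMod using (_/_; _%_)
open import Data.Fin using (Fin; toℕ)
open import Data.Fin.Subset using (Subset; _∈_; _∉_; Nonempty; ∣_∣)
open import Data.Product using (Σ; _×_; ∃)
open import Data.Sum using (_⊎_)
open import Relation.Binary.PropositionalEquality using (_≡_; _≢_)
open import Relation.Nullary using (¬_)
open import Function.Bundles using (_⇔_)

⌈_/_⌉ : ℕ → (b : ℕ) → .{{NonZero b}} → ℕ
⌈ a / b ⌉ = (a + (b ∸ 1)) / b

diff : {n : ℕ} → .{{NonZero n}} → Fin n → Fin n → ℕ
diff {n} u v = (toℕ v + (n ∸ toℕ u)) % n

Adj : (n d : ℕ) → .{{NonZero n}} → Fin n → Fin n → Set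
Adj n d u v = u ≢ v × (diff u v ≡ 1 ⊎ diff u v ≡ n ∸ 1 ⊎ diff u v ≡ d ⊎ diff u v ≡ n ∸ d)

InN : (n d : ℕ) → .{{NonZero n}} → Fin n → Fin n → Set
InN n d u w = w ≡ u ⊎ Adj n d u w

InI : (n d : ℕ) → .{{NonZero n}} → Subset n → Fin n → Fin n → Set
InI n d C u w = w ∈ C × InN n d u w

SameI : (n d : ℕ) → .{{NonZero n}} → Subset n → Fin n → Fin n → Set
SameI n d C u v = ∀ w → InI n d C u w ⇔ InI n d C v w

Dominating : (n d : ℕ) → .{{NonZero n}} → Subset n → Set
Dominating n d C = ∀ u → ∃ λ w → InI n d C u w

Identifying : (n d : ℕ) → .{{NonZero n}} → Subset n → Set
Identifying n d C = Nonempty C × Dominating n d C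
  × (∀ u v → u ≢ v → ¬ SameI n d C u v)

LocatingDominating : (n d : ℕ) → .{{NonZero n}} → Subset n → Set
LocatingDominating n d C = Nonempty C × Dominating n d C
  × (∀ u v → u ∉ C → v ∉ C → u ≢ v → ¬ SameI n d C u v)

SelfIdentifying : (n d : ℕ) → .{{NonZero n}} → Subset n → Set
SelfIdentifying n d C = Nonempty C
  × (∀ u v → u ≢ v → ∃ λ w → InI n d C u w × ¬ InI n d C v w)

module Submission where

-- Drawing the grid point (x , y) at x + y·d turns the closed neighbourhood of every vertex of
-- C_n(1,d) into the image of a plus-shaped ball of the square grid, so around each vertex u a
-- code C is seen as a 0/1 pattern on the radius-2 diamond, which must satisfy the local
-- domination and separation conditions of the code.  Discharging finishes the proof: every
-- vertex starts with charge B·[u ∈ C] − A and, for each of the eight orientations of a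
-- domino, sends ρ(w) to the next vertex, w being what the domino sees.  Translation invariance
-- makes total inflow equal total outflow, and an exhaustive check over all 2¹³ diamond patterns
-- shows that no final charge is negative, so A·n ≤ B·|C|.  The rules ρ for
-- (A , B) = (24 , 80), (56 , 160), (8 , 16) give the three bounds.

open import Data.Bool using (Bool; true; false; not; _∧_; _∨_; T; if_then_else_)
open import Data.Bool.ListAction using (any; all)
open import Data.Bool.Properties using (T-∧)
open import Data.Empty using (⊥)
open import Data.Fin using (Fin; zero; suc; toℕ) renaming (_≟_ to _≟ᶠ_)
open import Data.Fin.Permutation using (permutation)
open import Data.Fin.Properties using (toℕ-fromℕ<; toℕ-injective; toℕ<n; all?)
open import Data.Fin.Subset using (Subset; ∣_∣) renaming (_∈_ to _∈ˢ_; _∉_ to _∉ˢ_)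
open import Data.List using (List; []; _∷_; map)
open import Data.List.Membership.Propositional using (_∈_)
open import Data.List.Membership.Propositional.Properties using (∈-map⁺; ∈-map⁻)
import Data.List.Relation.Unary.All as All
open import Data.List.Relation.Unary.All using (All; []; _∷_)
open import Data.List.Relation.Unary.All.Properties using (all⁺; all⁻)
import Data.List.Relation.Unary.Any as Any
open import Data.List.Relation.Unary.Any using (here; there)
open import Data.List.Relation.Unary.Any.Properties using (any⁺; any⁻)
open import Data.Nat using (ℕ; zero; suc; _+_; _*_; _∸_; _≤_; _<_; _≡ᵇ_; _≤ᵇ_; NonZero; z≤n; s≤s; s≤s⁻¹; >-nonZero⁻¹)
open import Data.Nat.DivMod
open import Data.Nat.Properties
open import Algebra.Properties.CommutativeMonoid.Sum +-0-commutativeMonoid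
  using (sum; sum-permute; sum-cong-≗; ∑-comm; ∑-distrib-+)
open import Data.Nat.Tactic.RingSolver using (solve-∀)
open import Data.Product using (_×_; _,_; ∃; uncurry; proj₁; proj₂)
open import Data.Sum using (_⊎_; inj₁; inj₂)
open import Data.Unit using (tt)
open import Data.Vec using (Vec; lookup; []; _∷_)
import Data.Vec as Vec
open import Data.Vec.Properties using ([]=⇒lookup)
open import Data.Vec.Relation.Binary.Pointwise.Inductive as Pointwise using (Pointwise; []; _∷_)
open import Function using (_∘_)
open import Function.Bundles using (Equivalence; mk⇔)
open import Relation.Binary.PropositionalEquality
open import Relation.Nullary using (¬_; Dec; yes; no; _×-dec_)
open import Relation.Nullary.Decidable using (toWitness)
open ≡-Reasoning

open import Defs using (⌈_/_⌉; diff; InN; InI; SameI; Dominating; Identifying; LocatingDominating; SelfIdentifying)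

sum-const : ∀ {m} c → sum {m} (λ _ → c) ≡ m * c
sum-const {zero}  c = refl
sum-const {suc m} c = cong (c +_) (sum-const {m} c)

sum-mono-≤ : ∀ {m} {f g : Fin m → ℕ} → (∀ i → f i ≤ g i) → sum f ≤ sum g
sum-mono-≤ {zero}  f≤g = ≤-refl
sum-mono-≤ {suc m} f≤g = +-mono-≤ (f≤g zero) (sum-mono-≤ (f≤g ∘ suc))

sum-if : ∀ {m} (C : Subset m) B → sum (λ u → if lookup C u then B else 0) ≡ B * ∣ C ∣
sum-if []          B = sym (*-zeroʳ B)
sum-if (true ∷ C)  B = trans (cong (B +_) (sum-if C B)) (sym (*-suc B _))
sum-if (false ∷ C) B = sum-if C B

⌈/⌉-≤ : ∀ a b c .{{_ : NonZero b}} → a ≤ c * b → ⌈ a / b ⌉ ≤ c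
⌈/⌉-≤ a (suc b) c a≤cb = s≤s⁻¹ (m<n*o⇒m/o<n {a + b} {suc c} {suc b}
  (subst (a + b <_) (+-comm (c * suc b) (suc b)) (+-mono-≤-< a≤cb (n<1+n b))))

*-cancel-common-≤ : ∀ k a b m c .{{_ : NonZero k}} → m * (k * a) ≤ (k * b) * c → a * m ≤ c * b
*-cancel-common-≤ k a b m c le = *-cancelˡ-≤ k (subst₂ _≤_ (regroupˡ m k a) (regroupʳ k b c) le)
  where
  regroupˡ : ∀ m k a → m * (k * a) ≡ k * (a * m)
  regroupˡ = solve-∀
  regroupʳ : ∀ k b c → (k * b) * c ≡ k * (c * b)
  regroupʳ = solve-∀

T-lookup : ∀ {m} {C : Subset m} {w} → w ∈ˢ C → T (lookup C w)
T-lookup w∈C = subst T (sym ([]=⇒lookup w∈C)) tt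

lookup≡false⇒∉ : ∀ {m} {C : Subset m} {w} → lookup C w ≡ false → w ∉ˢ C
lookup≡false⇒∉ C[w]≡false w∈C with () ← trans (sym ([]=⇒lookup w∈C)) C[w]≡false

T-not-intro : ∀ {a} → ¬ T a → T (not a)
T-not-intro {true}  ¬a = ¬a _
T-not-intro {false} _  = _

T-∨-intro-false : ∀ {a b} → (a ≡ false → T b) → T (a ∨ b)
T-∨-intro-false {true}  _ = _
T-∨-intro-false {false} b = b refl

implicationᵇ : ∀ {a b} → T (not a ∨ b) → T a → T b
implicationᵇ {true} b _ = b

module Translation (n : ℕ) .{{_ : NonZero n}} where

  infixl 6 _⊕_
  _⊕_ : Fin n → ℕ → Fin n
  u ⊕ k = (toℕ u + k) mod n

  toℕ-⊕ : ∀ u k → toℕ (u ⊕ k) ≡ (toℕ u + k) % n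
  toℕ-⊕ u k = toℕ-fromℕ< (m%n<n (toℕ u + k) n)

  ⊕-cong-% : ∀ u {a b} → a % n ≡ b % n → u ⊕ a ≡ u ⊕ b
  ⊕-cong-% u {a} {b} a≡b = toℕ-injective (begin
    toℕ (u ⊕ a)              ≡⟨ toℕ-⊕ u a ⟩
    (toℕ u + a) % n          ≡⟨ %-distribˡ-+ (toℕ u) a n ⟩
    (toℕ u % n + a % n) % n  ≡⟨ cong (λ r → (toℕ u % n + r) % n) a≡b ⟩
    (toℕ u % n + b % n) % n  ≡⟨ %-distribˡ-+ (toℕ u) b n ⟨
    (toℕ u + b) % n          ≡⟨ toℕ-⊕ u b ⟨
    toℕ (u ⊕ b)              ∎)

  %-absorbˡ : ∀ a b → (a % n + b) % n ≡ (a + b) % n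
  %-absorbˡ a b = begin
    (a % n + b) % n          ≡⟨ %-distribˡ-+ (a % n) b n ⟩
    (a % n % n + b % n) % n  ≡⟨ cong (λ r → (r + b % n) % n) (m%n%n≡m%n a n) ⟩
    (a % n + b % n) % n      ≡⟨ %-distribˡ-+ a b n ⟨
    (a + b) % n              ∎

  ⊕-assoc : ∀ u a b → (u ⊕ a) ⊕ b ≡ u ⊕ (a + b)
  ⊕-assoc u a b = toℕ-injective (begin
    toℕ ((u ⊕ a) ⊕ b)          ≡⟨ toℕ-⊕ (u ⊕ a) b ⟩
    (toℕ (u ⊕ a) + b) % n      ≡⟨ cong (λ r → (r + b) % n) (toℕ-⊕ u a) ⟩
    ((toℕ u + a) % n + b) % n  ≡⟨ %-absorbˡ (toℕ u + a) b ⟩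
    (toℕ u + a + b) % n        ≡⟨ cong (_% n) (+-assoc (toℕ u) a b) ⟩
    (toℕ u + (a + b)) % n      ≡⟨ toℕ-⊕ u (a + b) ⟨
    toℕ (u ⊕ (a + b))          ∎)

  ⊕-identityʳ : ∀ u → u ⊕ 0 ≡ u
  ⊕-identityʳ u = toℕ-injective (begin
    toℕ (u ⊕ 0)        ≡⟨ toℕ-⊕ u 0 ⟩
    (toℕ u + 0) % n    ≡⟨ cong (_% n) (+-identityʳ (toℕ u)) ⟩
    toℕ u % n          ≡⟨ m<n⇒m%n≡m (toℕ<n u) ⟩
    toℕ u              ∎)

  ⊕-multiple : ∀ u k → u ⊕ k * n ≡ u
  ⊕-multiple u k = trans (⊕-cong-% u (trans (m*n%n≡0 k n) (sym (m<n⇒m%n≡m (>-nonZero⁻¹ n))))) (⊕-identityʳ u)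

  ⊕-⊕-multiple : ∀ u {a b} k → a + b ≡ k * n → (u ⊕ a) ⊕ b ≡ u
  ⊕-⊕-multiple u {a} {b} k a+b≡kn = begin
    (u ⊕ a) ⊕ b  ≡⟨ ⊕-assoc u a b ⟩
    u ⊕ (a + b)  ≡⟨ cong (u ⊕_) a+b≡kn ⟩
    u ⊕ k * n    ≡⟨ ⊕-multiple u k ⟩
    u            ∎

  ⊕-diff : ∀ u v → u ⊕ diff u v ≡ v
  ⊕-diff u v = toℕ-injective (begin
    toℕ (u ⊕ diff u v)                       ≡⟨ toℕ-⊕ u (diff u v) ⟩
    (toℕ u + (toℕ v + (n ∸ toℕ u)) % n) % n  ≡⟨ cong (_% n) (+-comm (toℕ u) _) ⟩
    ((toℕ v + (n ∸ toℕ u)) % n + toℕ u) % n  ≡⟨ %-absorbˡ (toℕ v + (n ∸ toℕ u)) (toℕ u) ⟩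
    (toℕ v + (n ∸ toℕ u) + toℕ u) % n        ≡⟨ cong (_% n) (+-assoc (toℕ v) _ _) ⟩
    (toℕ v + ((n ∸ toℕ u) + toℕ u)) % n      ≡⟨ cong (λ r → (toℕ v + r) % n) (m∸n+n≡m (<⇒≤ (toℕ<n u))) ⟩
    (toℕ v + n) % n                          ≡⟨ [m+n]%n≡m%n (toℕ v) n ⟩
    toℕ v % n                                ≡⟨ m<n⇒m%n≡m (toℕ<n v) ⟩
    toℕ v                                    ∎)

  diff≡⇒⊕≡ : ∀ u v {k} → diff u v ≡ k → u ⊕ k ≡ v
  diff≡⇒⊕≡ u v refl = ⊕-diff u v

  diff-⊕ : ∀ u {k} → k < n → diff u (u ⊕ k) ≡ k
  diff-⊕ u {k} k<n = begin
    (toℕ (u ⊕ k) + (n ∸ toℕ u)) % n      ≡⟨ cong (λ r → (r + (n ∸ toℕ u)) % n) (toℕ-⊕ u k) ⟩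
    ((toℕ u + k) % n + (n ∸ toℕ u)) % n  ≡⟨ %-absorbˡ (toℕ u + k) (n ∸ toℕ u) ⟩
    (toℕ u + k + (n ∸ toℕ u)) % n        ≡⟨ cong (_% n) (+-comm (toℕ u + k) _) ⟩
    ((n ∸ toℕ u) + (toℕ u + k)) % n      ≡⟨ cong (_% n) (+-assoc (n ∸ toℕ u) (toℕ u) k) ⟨
    ((n ∸ toℕ u) + toℕ u + k) % n        ≡⟨ cong (λ r → (r + k) % n) (m∸n+n≡m (<⇒≤ (toℕ<n u))) ⟩
    (n + k) % n                          ≡⟨ cong (_% n) (+-comm n k) ⟩
    (k + n) % n                          ≡⟨ [m+n]%n≡m%n k n ⟩
    k % n                                ≡⟨ m<n⇒m%n≡m k<n ⟩
    k                                    ∎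

  ⊕-cancelˡ : ∀ u {a b} → a < n → b < n → u ⊕ a ≡ u ⊕ b → a ≡ b
  ⊕-cancelˡ u {a} {b} a<n b<n eq = begin
    a                ≡⟨ diff-⊕ u a<n ⟨
    diff u (u ⊕ a)   ≡⟨ cong (diff u) eq ⟩
    diff u (u ⊕ b)   ≡⟨ diff-⊕ u b<n ⟩
    b                ∎

  k+[n∸1]k≡kn : ∀ k → k + (n ∸ 1) * k ≡ k * n
  k+[n∸1]k≡kn k = begin
    k + (n ∸ 1) * k    ≡⟨⟩
    (1 + (n ∸ 1)) * k  ≡⟨ cong (_* k) (m+[n∸m]≡n (>-nonZero⁻¹ n)) ⟩
    n * k              ≡⟨ *-comm n k ⟩
    k * n              ∎

  sum-⊕ : ∀ (g : Fin n → ℕ) k → sum (λ u → g (u ⊕ k)) ≡ sum g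
  sum-⊕ g k = sym (sum-permute g (permutation (_⊕ k) (_⊕ ((n ∸ 1) * k))
      (λ u → ⊕-⊕-multiple u k (trans (+-comm _ k) (k+[n∸1]k≡kn k)))
      (λ u → ⊕-⊕-multiple u k (k+[n∸1]k≡kn k))))

data Dir : Set where
  right left up down : Dir

directions : List Dir
directions = right ∷ left ∷ up ∷ down ∷ []

∈-directions : ∀ f → f ∈ directions
∈-directions right = here refl
∈-directions left  = there (here refl)
∈-directions up    = there (there (here refl))
∈-directions down  = there (there (there (here refl)))

Cell : Set
Cell = ℕ × ℕ

step : Dir → Cell → Cell
step right (x , y) = (suc x , y)
step left  (x , y) = (x ∸ 1 , y)
step up    (x , y) = (x , suc y)
step down  (x , y) = (x , y ∸ 1)

ball : Cell → List Cell
ball c = c ∷ map (λ f → step f c) directions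

centre : Cell
centre = (2 , 2)

north south : Cell
north = step up centre
south = step down centre

east west : Cell
east = step right centre
west = step left  centre

opposite : Dir → Dir
opposite right = left
opposite left  = right
opposite up    = down
opposite down  = up

Pattern : Set
Pattern = Cell → Bool

_==ᶜ_ : Cell → Cell → Bool
(x , y) ==ᶜ (x′ , y′) = (x ≡ᵇ x′) ∧ (y ≡ᵇ y′)

_∈ᵇ_ : Cell → List Cell → Bool
c ∈ᵇ cs = any (c ==ᶜ_) cs

∈ᵇ⇒∈ : ∀ c cs → T (c ∈ᵇ cs) → c ∈ cs
∈ᵇ⇒∈ c cs c∈cs = Any.map (λ {c′} → ==ᶜ⇒≡ c c′) (any⁻ (c ==ᶜ_) cs c∈cs)
  where
  ==ᶜ⇒≡ : ∀ c c′ → T (c ==ᶜ c′) → c ≡ c′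
  ==ᶜ⇒≡ (x , y) (x′ , y′) eq with Equivalence.to T-∧ eq
  ... | x≡ , y≡ = cong₂ _,_ (≡ᵇ⇒≡ x x′ x≡) (≡ᵇ⇒≡ y y′ y≡)

dominatedᵇ : Pattern → Cell → Bool
dominatedᵇ p c = any p (ball c)

-- I(C; c) ⊆ I(C; c′), read off the grid.
coversᵇ : Pattern → Cell → Cell → Bool
coversᵇ p c c′ = all (λ z → not (p z) ∨ z ∈ᵇ ball c′) (ball c)

Separation : Set
Separation = Pattern → Cell → Cell → Bool

separatesᴵᴰ separatesᴸᴰ separatesˢᴵᴰ : Separation
separatesᴵᴰ  p c c′ = not (coversᵇ p c c′ ∧ coversᵇ p c′ c)
separatesᴸᴰ  p c c′ = p c ∨ p c′ ∨ separatesᴵᴰ p c c′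
separatesˢᴵᴰ p c c′ = not (coversᵇ p c c′) ∧ not (coversᵇ p c′ c)

innerPairs : List (Cell × Cell)
innerPairs = (centre , east) ∷ (centre , west) ∷ (centre , north) ∷ (centre , south)
           ∷ (east , west) ∷ (east , north) ∷ (east , south) ∷ (west , north) ∷ (west , south)
           ∷ (north , south) ∷ []

separatesᴵᴰ-intro : ∀ p c c′ → (T (coversᵇ p c c′) → T (coversᵇ p c′ c) → ⊥) → T (separatesᴵᴰ p c c′)
separatesᴵᴰ-intro p c c′ ¬both = T-not-intro (λ both → uncurry ¬both (Equivalence.to (T-∧ {coversᵇ p c c′}) both))

separatesᴵᴰ-introˡ : ∀ p c c′ → ¬ T (coversᵇ p c c′) → T (separatesᴵᴰ p c c′)
separatesᴵᴰ-introˡ p c c′ ¬covers = separatesᴵᴰ-intro p c c′ (λ covers _ → ¬covers covers)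

separatesᴸᴰ-intro : ∀ p c c′ → (p c ≡ false → p c′ ≡ false → T (separatesᴵᴰ p c c′)) → T (separatesᴸᴰ p c c′)
separatesᴸᴰ-intro p c c′ sep = T-∨-intro-false {p c} λ c∉ → T-∨-intro-false {p c′} (sep c∉)

separatesˢᴵᴰ-intro : ∀ p c c′ → ¬ T (coversᵇ p c c′) → ¬ T (coversᵇ p c′ c) → T (separatesˢᴵᴰ p c c′)
separatesˢᴵᴰ-intro p c c′ ¬covers ¬covers′ = Equivalence.from T-∧ (T-not-intro ¬covers , T-not-intro ¬covers′)

valid : Separation → Pattern → Bool
valid sep p = all (dominatedᵇ p) (ball centre) ∧ all (uncurry (sep p)) innerPairs

-- If north and south are the same vertex, so are (2 , 4) and the centre; as (2 , 4) is not
-- adjacent to south, south covers north only if no code cell lies around north.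
north-wrap : ∀ p → p (2 , 4) ≡ p centre → T (dominatedᵇ p north) → ¬ T (coversᵇ p north south)
north-wrap p wrap dom with p (2 , 3) | p (3 , 3) | p (1 , 3) | p (2 , 4) | p centre
... | true  | _     | _     | _     | _     = λ ()
... | false | true  | _     | _     | _     = λ ()
... | false | false | true  | _     | _     = λ ()
... | false | false | false | true  | _     = λ ()
north-wrap p () dom | false | false | false | false | true
... | false | false | false | false | false = λ _ → dom

south-wrap : ∀ p → p (2 , 0) ≡ p centre → T (dominatedᵇ p south) → ¬ T (coversᵇ p south north)
south-wrap p wrap dom with p (2 , 1) | p (3 , 1) | p (1 , 1) | p centre | p (2 , 0)
... | true  | _     | _     | _     | _     = λ ()
... | false | true  | _     | _     | _     = λ ()
... | false | false | true  | _     | _     = λ ()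
... | false | false | false | true  | true  = λ ()
south-wrap p () dom | false | false | false | true | false
... | false | false | false | false | true  = λ ()
... | false | false | false | false | false = λ _ → dom

Orientation : Set
Orientation = Dir × Dir

-- (forward , sideways): the eight symmetries of the square.
orientations : Vec Orientation 8
orientations = (right , up) ∷ (right , down) ∷ (left , up) ∷ (left , down)
             ∷ (up , right) ∷ (up , left) ∷ (down , right) ∷ (down , left) ∷ []

-- The union of the balls around c and step f c, listed in a fixed order relative to (f , s).
domino : Orientation → Cell → Vec Cell 8
domino (f , s) c = step (opposite f) c ∷ step (opposite s) c ∷ c ∷ step s c
                 ∷ step (opposite s) c′ ∷ c′ ∷ step s c′ ∷ step f c′ ∷ []
  where c′ = step f c

predecessor : Orientation → Cell
predecessor (f , _) = step (opposite f) centre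

Window : Set
Window = Vec Bool 8

Rule : Set
Rule = Window → ℕ

read : ∀ {k} → Pattern → Vec Cell k → Vec Bool k
read p = Vec.map p

outflow inflow : Rule → Pattern → ℕ
outflow ρ p = sum λ i → ρ (read p (domino (Vec.lookup orientations i) centre))
inflow  ρ p = sum λ i → let o = Vec.lookup orientations i in ρ (read p (domino o (predecessor o)))

charge : ℕ → Pattern → ℕ
charge B p = if p centre then B else 0

balancedᵇ : Separation → Rule → ℕ → ℕ → Pattern → Bool
balancedᵇ sep ρ A B p = not (valid sep p) ∨ (A + outflow ρ p ≤ᵇ charge B p + inflow ρ p)

-- Cell (x , y) seen from the grid point p is cell (x′ , y′) seen from the centre.
Translates : Cell → Cell → Cell → Set
Translates (a , b) (x , y) (x′ , y′) = x + a ≡ x′ + 2 × y + b ≡ y′ + 2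

translates? : ∀ p c c′ → Dec (Translates p c c′)
translates? (a , b) (x , y) (x′ , y′) = (x + a ≟ x′ + 2) ×-dec (y + b ≟ y′ + 2)

domino-predecessor : ∀ i → let o = Vec.lookup orientations i in
                     Pointwise (Translates (predecessor o)) (domino o centre) (domino o (predecessor o))
domino-predecessor = toWitness {a? = all? λ i → Pointwise.decidable (translates? _) _ _} _

every : ∀ k → (Vec Bool k → Bool) → Bool
every zero    P = P []
every (suc k) P = every k (P ∘ (true ∷_)) ∧ every k (P ∘ (false ∷_))

every-sound : ∀ k P → T (every k P) → ∀ v → T (P v)
every-sound zero    P holds []           = holds
every-sound (suc k) P holds (true ∷ v)  = every-sound k (P ∘ (true ∷_)) (proj₁ (Equivalence.to T-∧ holds)) v
every-sound (suc k) P holds (false ∷ v) = every-sound k (P ∘ (false ∷_)) (proj₂ (Equivalence.to (T-∧ {every k (P ∘ (true ∷_))}) holds)) v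

diamond : Vec Cell 13
diamond = (0 , 2) ∷ (1 , 1) ∷ (1 , 2) ∷ (1 , 3) ∷ (2 , 0) ∷ (2 , 1) ∷ (2 , 2)
        ∷ (2 , 3) ∷ (2 , 4) ∷ (3 , 1) ∷ (3 , 2) ∷ (3 , 3) ∷ (4 , 2) ∷ []

extend : ∀ {k} → Vec Cell k → Vec Bool k → Pattern
extend []       []       _ = false
extend (c ∷ cs) (b ∷ bs) z = if z ==ᶜ c then b else extend cs bs z

-- The hypothesis holds by refl for any P that only inspects cells of the diamond.
exhaustive : ∀ (P : Pattern → Bool) → (∀ p → P (extend diamond (read p diamond)) ≡ P p) →
             T (every 13 (P ∘ extend diamond)) → ∀ p → T (P p)
exhaustive P local holds p = subst T (local p) (every-sound 13 (P ∘ extend diamond) holds (read p diamond))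

balanced : ∀ sep ρ A B → (∀ p → T (balancedᵇ sep ρ A B p)) →
           ∀ p → T (valid sep p) → A + outflow ρ p ≤ charge B p + inflow ρ p
balanced sep ρ A B holds p valid-p = ≤ᵇ⇒≤ _ _ (implicationᵇ (holds p) valid-p)

pattern ● = true
pattern ○ = false

-- The rules were found by linear programming; ● marks a code cell.
ρᴵᴰ : Rule
ρᴵᴰ (○ ∷ ○ ∷ ○ ∷ ● ∷ ○ ∷ ○ ∷ ○ ∷ ● ∷ []) = 1
ρᴵᴰ (○ ∷ ○ ∷ ○ ∷ ● ∷ ● ∷ ○ ∷ ● ∷ ○ ∷ []) = 1
ρᴵᴰ (○ ∷ ○ ∷ ● ∷ ○ ∷ ○ ∷ ○ ∷ ○ ∷ ● ∷ []) = 13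
ρᴵᴰ (○ ∷ ○ ∷ ● ∷ ○ ∷ ○ ∷ ○ ∷ ● ∷ ○ ∷ []) = 28
ρᴵᴰ (○ ∷ ○ ∷ ● ∷ ○ ∷ ○ ∷ ○ ∷ ● ∷ ● ∷ []) = 24
ρᴵᴰ (○ ∷ ○ ∷ ● ∷ ○ ∷ ● ∷ ○ ∷ ● ∷ ○ ∷ []) = 11
ρᴵᴰ (○ ∷ ○ ∷ ● ∷ ○ ∷ ● ∷ ○ ∷ ● ∷ ● ∷ []) = 7
ρᴵᴰ (○ ∷ ○ ∷ ● ∷ ● ∷ ○ ∷ ○ ∷ ○ ∷ ○ ∷ []) = 59
ρᴵᴰ (○ ∷ ○ ∷ ● ∷ ● ∷ ○ ∷ ○ ∷ ○ ∷ ● ∷ []) = 27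
ρᴵᴰ (○ ∷ ○ ∷ ● ∷ ● ∷ ○ ∷ ○ ∷ ● ∷ ○ ∷ []) = 28
ρᴵᴰ (○ ∷ ○ ∷ ● ∷ ● ∷ ○ ∷ ○ ∷ ● ∷ ● ∷ []) = 21
ρᴵᴰ (○ ∷ ○ ∷ ● ∷ ● ∷ ○ ∷ ● ∷ ○ ∷ ○ ∷ []) = 9
ρᴵᴰ (○ ∷ ○ ∷ ● ∷ ● ∷ ○ ∷ ● ∷ ○ ∷ ● ∷ []) = 9
ρᴵᴰ (○ ∷ ○ ∷ ● ∷ ● ∷ ● ∷ ○ ∷ ○ ∷ ○ ∷ []) = 29
ρᴵᴰ (○ ∷ ○ ∷ ● ∷ ● ∷ ● ∷ ○ ∷ ○ ∷ ● ∷ []) = 25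
ρᴵᴰ (○ ∷ ○ ∷ ● ∷ ● ∷ ● ∷ ○ ∷ ● ∷ ○ ∷ []) = 18
ρᴵᴰ (○ ∷ ○ ∷ ● ∷ ● ∷ ● ∷ ○ ∷ ● ∷ ● ∷ []) = 14
ρᴵᴰ (○ ∷ ● ∷ ● ∷ ● ∷ ○ ∷ ○ ∷ ○ ∷ ○ ∷ []) = 30
ρᴵᴰ (○ ∷ ● ∷ ● ∷ ● ∷ ○ ∷ ○ ∷ ○ ∷ ● ∷ []) = 14
ρᴵᴰ (○ ∷ ● ∷ ● ∷ ● ∷ ○ ∷ ○ ∷ ● ∷ ○ ∷ []) = 29
ρᴵᴰ (○ ∷ ● ∷ ● ∷ ● ∷ ○ ∷ ○ ∷ ● ∷ ● ∷ []) = 21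
ρᴵᴰ (○ ∷ ● ∷ ● ∷ ● ∷ ○ ∷ ● ∷ ○ ∷ ○ ∷ []) = 5
ρᴵᴰ (○ ∷ ● ∷ ● ∷ ● ∷ ● ∷ ○ ∷ ● ∷ ○ ∷ []) = 7
ρᴵᴰ (○ ∷ ● ∷ ● ∷ ● ∷ ● ∷ ○ ∷ ● ∷ ● ∷ []) = 7
ρᴵᴰ (● ∷ ○ ∷ ○ ∷ ○ ∷ ● ∷ ○ ∷ ● ∷ ○ ∷ []) = 1
ρᴵᴰ (● ∷ ○ ∷ ○ ∷ ● ∷ ● ∷ ○ ∷ ● ∷ ○ ∷ []) = 1
ρᴵᴰ (● ∷ ○ ∷ ● ∷ ○ ∷ ○ ∷ ○ ∷ ○ ∷ ○ ∷ []) = 29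
ρᴵᴰ (● ∷ ○ ∷ ● ∷ ○ ∷ ○ ∷ ○ ∷ ○ ∷ ● ∷ []) = 13
ρᴵᴰ (● ∷ ○ ∷ ● ∷ ○ ∷ ○ ∷ ○ ∷ ● ∷ ○ ∷ []) = 28
ρᴵᴰ (● ∷ ○ ∷ ● ∷ ○ ∷ ○ ∷ ○ ∷ ● ∷ ● ∷ []) = 17
ρᴵᴰ (● ∷ ○ ∷ ● ∷ ○ ∷ ○ ∷ ● ∷ ○ ∷ ○ ∷ []) = 4
ρᴵᴰ (● ∷ ○ ∷ ● ∷ ○ ∷ ○ ∷ ● ∷ ● ∷ ● ∷ []) = 7
ρᴵᴰ (● ∷ ○ ∷ ● ∷ ○ ∷ ● ∷ ○ ∷ ● ∷ ○ ∷ []) = 11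
ρᴵᴰ (● ∷ ○ ∷ ● ∷ ○ ∷ ● ∷ ○ ∷ ● ∷ ● ∷ []) = 7
ρᴵᴰ (● ∷ ○ ∷ ● ∷ ○ ∷ ● ∷ ● ∷ ● ∷ ○ ∷ []) = 19
ρᴵᴰ (● ∷ ○ ∷ ● ∷ ● ∷ ○ ∷ ○ ∷ ○ ∷ ○ ∷ []) = 59
ρᴵᴰ (● ∷ ○ ∷ ● ∷ ● ∷ ○ ∷ ○ ∷ ○ ∷ ● ∷ []) = 27
ρᴵᴰ (● ∷ ○ ∷ ● ∷ ● ∷ ○ ∷ ○ ∷ ● ∷ ○ ∷ []) = 28
ρᴵᴰ (● ∷ ○ ∷ ● ∷ ● ∷ ○ ∷ ○ ∷ ● ∷ ● ∷ []) = 21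
ρᴵᴰ (● ∷ ○ ∷ ● ∷ ● ∷ ○ ∷ ● ∷ ○ ∷ ○ ∷ []) = 17
ρᴵᴰ (● ∷ ○ ∷ ● ∷ ● ∷ ● ∷ ○ ∷ ○ ∷ ○ ∷ []) = 29
ρᴵᴰ (● ∷ ○ ∷ ● ∷ ● ∷ ● ∷ ○ ∷ ○ ∷ ● ∷ []) = 43
ρᴵᴰ (● ∷ ○ ∷ ● ∷ ● ∷ ● ∷ ○ ∷ ● ∷ ○ ∷ []) = 18
ρᴵᴰ (● ∷ ○ ∷ ● ∷ ● ∷ ● ∷ ○ ∷ ● ∷ ● ∷ []) = 14
ρᴵᴰ (● ∷ ● ∷ ● ∷ ● ∷ ○ ∷ ○ ∷ ○ ∷ ○ ∷ []) = 30
ρᴵᴰ (● ∷ ● ∷ ● ∷ ● ∷ ○ ∷ ○ ∷ ○ ∷ ● ∷ []) = 14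
ρᴵᴰ (● ∷ ● ∷ ● ∷ ● ∷ ○ ∷ ○ ∷ ● ∷ ○ ∷ []) = 29
ρᴵᴰ (● ∷ ● ∷ ● ∷ ● ∷ ○ ∷ ○ ∷ ● ∷ ● ∷ []) = 21
ρᴵᴰ (● ∷ ● ∷ ● ∷ ● ∷ ○ ∷ ● ∷ ○ ∷ ○ ∷ []) = 5
ρᴵᴰ (● ∷ ● ∷ ● ∷ ● ∷ ○ ∷ ● ∷ ○ ∷ ● ∷ []) = 13
ρᴵᴰ (● ∷ ● ∷ ● ∷ ● ∷ ● ∷ ○ ∷ ● ∷ ○ ∷ []) = 7
ρᴵᴰ (● ∷ ● ∷ ● ∷ ● ∷ ● ∷ ○ ∷ ● ∷ ● ∷ []) = 7
ρᴵᴰ _ = 0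

ρᴸᴰ : Rule
ρᴸᴰ (○ ∷ ○ ∷ ○ ∷ ● ∷ ● ∷ ○ ∷ ● ∷ ○ ∷ []) = 1
ρᴸᴰ (○ ∷ ○ ∷ ○ ∷ ● ∷ ● ∷ ○ ∷ ● ∷ ● ∷ []) = 1
ρᴸᴰ (○ ∷ ○ ∷ ● ∷ ○ ∷ ○ ∷ ○ ∷ ○ ∷ ○ ∷ []) = 13
ρᴸᴰ (○ ∷ ○ ∷ ● ∷ ○ ∷ ○ ∷ ○ ∷ ○ ∷ ● ∷ []) = 5
ρᴸᴰ (○ ∷ ○ ∷ ● ∷ ○ ∷ ○ ∷ ○ ∷ ● ∷ ○ ∷ []) = 12
ρᴸᴰ (○ ∷ ○ ∷ ● ∷ ○ ∷ ○ ∷ ○ ∷ ● ∷ ● ∷ []) = 8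
ρᴸᴰ (○ ∷ ○ ∷ ● ∷ ○ ∷ ○ ∷ ● ∷ ● ∷ ● ∷ []) = 5
ρᴸᴰ (○ ∷ ○ ∷ ● ∷ ○ ∷ ● ∷ ○ ∷ ● ∷ ○ ∷ []) = 3
ρᴸᴰ (○ ∷ ○ ∷ ● ∷ ○ ∷ ● ∷ ○ ∷ ● ∷ ● ∷ []) = 3
ρᴸᴰ (○ ∷ ○ ∷ ● ∷ ● ∷ ○ ∷ ○ ∷ ○ ∷ ○ ∷ []) = 27
ρᴸᴰ (○ ∷ ○ ∷ ● ∷ ● ∷ ○ ∷ ○ ∷ ○ ∷ ● ∷ []) = 11
ρᴸᴰ (○ ∷ ○ ∷ ● ∷ ● ∷ ○ ∷ ○ ∷ ● ∷ ○ ∷ []) = 12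
ρᴸᴰ (○ ∷ ○ ∷ ● ∷ ● ∷ ○ ∷ ○ ∷ ● ∷ ● ∷ []) = 14
ρᴸᴰ (○ ∷ ○ ∷ ● ∷ ● ∷ ○ ∷ ● ∷ ○ ∷ ● ∷ []) = 9
ρᴸᴰ (○ ∷ ○ ∷ ● ∷ ● ∷ ● ∷ ○ ∷ ○ ∷ ○ ∷ []) = 13
ρᴸᴰ (○ ∷ ○ ∷ ● ∷ ● ∷ ● ∷ ○ ∷ ● ∷ ● ∷ []) = 6
ρᴸᴰ (○ ∷ ● ∷ ○ ∷ ● ∷ ● ∷ ● ∷ ● ∷ ○ ∷ []) = 3
ρᴸᴰ (○ ∷ ● ∷ ○ ∷ ● ∷ ● ∷ ● ∷ ● ∷ ● ∷ []) = 3
ρᴸᴰ (○ ∷ ● ∷ ● ∷ ○ ∷ ○ ∷ ○ ∷ ● ∷ ● ∷ []) = 10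
ρᴸᴰ (○ ∷ ● ∷ ● ∷ ● ∷ ○ ∷ ○ ∷ ○ ∷ ○ ∷ []) = 14
ρᴸᴰ (○ ∷ ● ∷ ● ∷ ● ∷ ○ ∷ ○ ∷ ○ ∷ ● ∷ []) = 6
ρᴸᴰ (○ ∷ ● ∷ ● ∷ ● ∷ ○ ∷ ○ ∷ ● ∷ ○ ∷ []) = 13
ρᴸᴰ (○ ∷ ● ∷ ● ∷ ● ∷ ○ ∷ ○ ∷ ● ∷ ● ∷ []) = 16
ρᴸᴰ (○ ∷ ● ∷ ● ∷ ● ∷ ○ ∷ ● ∷ ○ ∷ ○ ∷ []) = 19
ρᴸᴰ (○ ∷ ● ∷ ● ∷ ● ∷ ● ∷ ○ ∷ ● ∷ ● ∷ []) = 3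
ρᴸᴰ (● ∷ ○ ∷ ○ ∷ ○ ∷ ● ∷ ○ ∷ ● ∷ ○ ∷ []) = 1
ρᴸᴰ (● ∷ ○ ∷ ○ ∷ ○ ∷ ● ∷ ○ ∷ ● ∷ ● ∷ []) = 1
ρᴸᴰ (● ∷ ○ ∷ ○ ∷ ● ∷ ● ∷ ○ ∷ ● ∷ ○ ∷ []) = 1
ρᴸᴰ (● ∷ ○ ∷ ● ∷ ○ ∷ ○ ∷ ○ ∷ ○ ∷ ○ ∷ []) = 13
ρᴸᴰ (● ∷ ○ ∷ ● ∷ ○ ∷ ○ ∷ ○ ∷ ○ ∷ ● ∷ []) = 5
ρᴸᴰ (● ∷ ○ ∷ ● ∷ ○ ∷ ○ ∷ ○ ∷ ● ∷ ○ ∷ []) = 12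
ρᴸᴰ (● ∷ ○ ∷ ● ∷ ○ ∷ ○ ∷ ○ ∷ ● ∷ ● ∷ []) = 8
ρᴸᴰ (● ∷ ○ ∷ ● ∷ ○ ∷ ○ ∷ ● ∷ ● ∷ ● ∷ []) = 5
ρᴸᴰ (● ∷ ○ ∷ ● ∷ ○ ∷ ● ∷ ○ ∷ ● ∷ ○ ∷ []) = 15
ρᴸᴰ (● ∷ ○ ∷ ● ∷ ○ ∷ ● ∷ ○ ∷ ● ∷ ● ∷ []) = 3
ρᴸᴰ (● ∷ ○ ∷ ● ∷ ○ ∷ ● ∷ ● ∷ ● ∷ ○ ∷ []) = 11
ρᴸᴰ (● ∷ ○ ∷ ● ∷ ● ∷ ○ ∷ ○ ∷ ○ ∷ ○ ∷ []) = 27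
ρᴸᴰ (● ∷ ○ ∷ ● ∷ ● ∷ ○ ∷ ○ ∷ ○ ∷ ● ∷ []) = 11
ρᴸᴰ (● ∷ ○ ∷ ● ∷ ● ∷ ○ ∷ ○ ∷ ● ∷ ○ ∷ []) = 12
ρᴸᴰ (● ∷ ○ ∷ ● ∷ ● ∷ ○ ∷ ○ ∷ ● ∷ ● ∷ []) = 14
ρᴸᴰ (● ∷ ○ ∷ ● ∷ ● ∷ ● ∷ ○ ∷ ○ ∷ ○ ∷ []) = 13
ρᴸᴰ (● ∷ ○ ∷ ● ∷ ● ∷ ● ∷ ○ ∷ ● ∷ ● ∷ []) = 6
ρᴸᴰ (● ∷ ● ∷ ● ∷ ○ ∷ ○ ∷ ○ ∷ ● ∷ ● ∷ []) = 19
ρᴸᴰ (● ∷ ● ∷ ● ∷ ● ∷ ○ ∷ ○ ∷ ○ ∷ ○ ∷ []) = 14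
ρᴸᴰ (● ∷ ● ∷ ● ∷ ● ∷ ○ ∷ ○ ∷ ○ ∷ ● ∷ []) = 14
ρᴸᴰ (● ∷ ● ∷ ● ∷ ● ∷ ○ ∷ ○ ∷ ● ∷ ○ ∷ []) = 13
ρᴸᴰ (● ∷ ● ∷ ● ∷ ● ∷ ○ ∷ ○ ∷ ● ∷ ● ∷ []) = 16
ρᴸᴰ (● ∷ ● ∷ ● ∷ ● ∷ ○ ∷ ● ∷ ○ ∷ ● ∷ []) = 7
ρᴸᴰ (● ∷ ● ∷ ● ∷ ● ∷ ● ∷ ○ ∷ ● ∷ ● ∷ []) = 3
ρᴸᴰ _ = 0

ρˢᴵᴰ : Rule
ρˢᴵᴰ (○ ∷ ○ ∷ ● ∷ ● ∷ ○ ∷ ○ ∷ ● ∷ ○ ∷ []) = 4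
ρˢᴵᴰ (○ ∷ ○ ∷ ● ∷ ● ∷ ● ∷ ○ ∷ ○ ∷ ○ ∷ []) = 8
ρˢᴵᴰ (○ ∷ ○ ∷ ● ∷ ● ∷ ● ∷ ○ ∷ ○ ∷ ● ∷ []) = 4
ρˢᴵᴰ (○ ∷ ○ ∷ ● ∷ ● ∷ ● ∷ ○ ∷ ● ∷ ● ∷ []) = 2
ρˢᴵᴰ (○ ∷ ○ ∷ ● ∷ ● ∷ ● ∷ ● ∷ ○ ∷ ● ∷ []) = 2
ρˢᴵᴰ (○ ∷ ● ∷ ● ∷ ● ∷ ○ ∷ ○ ∷ ○ ∷ ● ∷ []) = 2
ρˢᴵᴰ (○ ∷ ● ∷ ● ∷ ● ∷ ○ ∷ ○ ∷ ● ∷ ○ ∷ []) = 8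
ρˢᴵᴰ (○ ∷ ● ∷ ● ∷ ● ∷ ○ ∷ ○ ∷ ● ∷ ● ∷ []) = 4
ρˢᴵᴰ (○ ∷ ● ∷ ● ∷ ● ∷ ● ∷ ○ ∷ ● ∷ ○ ∷ []) = 2
ρˢᴵᴰ (○ ∷ ● ∷ ● ∷ ● ∷ ● ∷ ○ ∷ ● ∷ ● ∷ []) = 1
ρˢᴵᴰ (● ∷ ○ ∷ ○ ∷ ○ ∷ ● ∷ ○ ∷ ● ∷ ○ ∷ []) = 4
ρˢᴵᴰ (● ∷ ○ ∷ ○ ∷ ○ ∷ ● ∷ ○ ∷ ● ∷ ● ∷ []) = 4
ρˢᴵᴰ (● ∷ ○ ∷ ○ ∷ ● ∷ ● ∷ ○ ∷ ● ∷ ○ ∷ []) = 4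
ρˢᴵᴰ (● ∷ ○ ∷ ○ ∷ ● ∷ ● ∷ ○ ∷ ● ∷ ● ∷ []) = 4
ρˢᴵᴰ (● ∷ ○ ∷ ● ∷ ○ ∷ ○ ∷ ○ ∷ ● ∷ ○ ∷ []) = 4
ρˢᴵᴰ (● ∷ ○ ∷ ● ∷ ○ ∷ ● ∷ ○ ∷ ● ∷ ● ∷ []) = 1
ρˢᴵᴰ (● ∷ ○ ∷ ● ∷ ● ∷ ○ ∷ ○ ∷ ● ∷ ○ ∷ []) = 4
ρˢᴵᴰ (● ∷ ○ ∷ ● ∷ ● ∷ ○ ∷ ○ ∷ ● ∷ ● ∷ []) = 2
ρˢᴵᴰ (● ∷ ○ ∷ ● ∷ ● ∷ ● ∷ ○ ∷ ○ ∷ ○ ∷ []) = 8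
ρˢᴵᴰ (● ∷ ○ ∷ ● ∷ ● ∷ ● ∷ ○ ∷ ○ ∷ ● ∷ []) = 4
ρˢᴵᴰ (● ∷ ○ ∷ ● ∷ ● ∷ ● ∷ ○ ∷ ● ∷ ● ∷ []) = 2
ρˢᴵᴰ (● ∷ ● ∷ ● ∷ ● ∷ ○ ∷ ○ ∷ ○ ∷ ● ∷ []) = 4
ρˢᴵᴰ (● ∷ ● ∷ ● ∷ ● ∷ ○ ∷ ○ ∷ ● ∷ ○ ∷ []) = 8
ρˢᴵᴰ (● ∷ ● ∷ ● ∷ ● ∷ ○ ∷ ○ ∷ ● ∷ ● ∷ []) = 4
ρˢᴵᴰ (● ∷ ● ∷ ● ∷ ● ∷ ● ∷ ○ ∷ ● ∷ ● ∷ []) = 1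
ρˢᴵᴰ _ = 0

balancedᴵᴰ : ∀ p → T (valid separatesᴵᴰ p) → 56 + outflow ρᴵᴰ p ≤ charge 160 p + inflow ρᴵᴰ p
balancedᴵᴰ = balanced separatesᴵᴰ ρᴵᴰ 56 160 (exhaustive (balancedᵇ separatesᴵᴰ ρᴵᴰ 56 160) (λ _ → refl) _)

balancedᴸᴰ : ∀ p → T (valid separatesᴸᴰ p) → 24 + outflow ρᴸᴰ p ≤ charge 80 p + inflow ρᴸᴰ p
balancedᴸᴰ = balanced separatesᴸᴰ ρᴸᴰ 24 80 (exhaustive (balancedᵇ separatesᴸᴰ ρᴸᴰ 24 80) (λ _ → refl) _)

balancedˢᴵᴰ : ∀ p → T (valid separatesˢᴵᴰ p) → 8 + outflow ρˢᴵᴰ p ≤ charge 16 p + inflow ρˢᴵᴰ p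
balancedˢᴵᴰ = balanced separatesˢᴵᴰ ρˢᴵᴰ 8 16 (exhaustive (balancedᵇ separatesˢᴵᴰ ρˢᴵᴰ 8 16) (λ _ → refl) _)

module Circulant (n d : ℕ) .{{_ : NonZero n}} (2≤d : 2 ≤ d) (2d≤n : 2 * d ≤ n) where

  open Translation n public

  shift : Dir → ℕ
  shift right = 1
  shift left  = n ∸ 1
  shift up    = d
  shift down  = n ∸ d

  d+d≤n : d + d ≤ n
  d+d≤n = ≤-trans (≤-reflexive (cong (d +_) (sym (+-identityʳ d)))) 2d≤n

  d<n : d < n
  d<n = <-≤-trans (m<m+n d (≤-trans (s≤s z≤n) 2≤d)) d+d≤n

  1<n : 1 < n
  1<n = <-trans 2≤d d<n

  0<shift : ∀ f → 0 < shift f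
  0<shift right = s≤s z≤n
  0<shift left  = m<n⇒0<n∸m 1<n
  0<shift up    = <-trans (s≤s z≤n) 2≤d
  0<shift down  = m<n⇒0<n∸m d<n

  shift<n : ∀ f → shift f < n
  shift<n right = 1<n
  shift<n left  = ∸-monoʳ-< (s≤s z≤n) (<⇒≤ 1<n)
  shift<n up    = d<n
  shift<n down  = ∸-monoʳ-< (0<shift up) (<⇒≤ d<n)

  ≢⊕shift : ∀ v f → v ≢ v ⊕ shift f
  ≢⊕shift v f v≡ = <⇒≢ (0<shift f) (⊕-cancelˡ v (>-nonZero⁻¹ n) (shift<n f) (trans (⊕-identityʳ v) v≡))

  InN⇒shift : ∀ {v w} → InN n d v w → w ≡ v ⊎ ∃ λ f → v ⊕ shift f ≡ w
  InN⇒shift (inj₁ w≡v)                                = inj₁ w≡v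
  InN⇒shift {v} {w} (inj₂ (_ , inj₁ e))               = inj₂ (right , diff≡⇒⊕≡ v w e)
  InN⇒shift {v} {w} (inj₂ (_ , inj₂ (inj₁ e)))        = inj₂ (left  , diff≡⇒⊕≡ v w e)
  InN⇒shift {v} {w} (inj₂ (_ , inj₂ (inj₂ (inj₁ e)))) = inj₂ (up    , diff≡⇒⊕≡ v w e)
  InN⇒shift {v} {w} (inj₂ (_ , inj₂ (inj₂ (inj₂ e)))) = inj₂ (down  , diff≡⇒⊕≡ v w e)

  shift⇒InN : ∀ v f → InN n d v (v ⊕ shift f)
  shift⇒InN v f = inj₂ (≢⊕shift v f , adjacent f (diff-⊕ v (shift<n f)))
    where
    adjacent : ∀ f {k} → k ≡ shift f → k ≡ 1 ⊎ k ≡ n ∸ 1 ⊎ k ≡ d ⊎ k ≡ n ∸ d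
    adjacent right = inj₁
    adjacent left  = inj₂ ∘ inj₁
    adjacent up    = inj₂ ∘ inj₂ ∘ inj₁
    adjacent down  = inj₂ ∘ inj₂ ∘ inj₂

  -- (n ∸ 1) * m ≡ - m (mod n): the cell (0 , 0) is drawn at u - 2 - 2d, so u sits at the
  -- centre and its whole radius-2 ball has natural coordinates.
  offset : Cell → ℕ
  offset (x , y) = (n ∸ 1) * (2 + 2 * d) + (x + y * d)

  at : Fin n → Cell → Fin n
  at u c = u ⊕ offset c

  at-centre : ∀ u → at u centre ≡ u
  at-centre u = begin
    u ⊕ ((n ∸ 1) * m + m)  ≡⟨ cong (u ⊕_) (trans (+-comm _ m) (k+[n∸1]k≡kn m)) ⟩
    u ⊕ m * n              ≡⟨ ⊕-multiple u m ⟩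
    u                      ∎
    where m = 2 + 2 * d

  at-right : ∀ u x y → at u (suc x , y) ≡ at u (x , y) ⊕ 1
  at-right u x y = sym (trans (⊕-assoc u _ 1) (cong (u ⊕_) (regroup ((n ∸ 1) * (2 + 2 * d)) x (y * d))))
    where
    regroup : ∀ k x z → k + (x + z) + 1 ≡ k + (suc x + z)
    regroup = solve-∀

  at-up : ∀ u x y → at u (x , suc y) ≡ at u (x , y) ⊕ d
  at-up u x y = sym (trans (⊕-assoc u _ d) (cong (u ⊕_) (regroup ((n ∸ 1) * (2 + 2 * d)) x (y * d) d)))
    where
    regroup : ∀ k x z d → k + (x + z) + d ≡ k + (x + (d + z))
    regroup = solve-∀

  at-left : ∀ u x y → at u (x , y) ≡ at u (suc x , y) ⊕ (n ∸ 1)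
  at-left u x y = sym (begin
    at u (suc x , y) ⊕ (n ∸ 1)        ≡⟨ cong (_⊕ (n ∸ 1)) (at-right u x y) ⟩
    (at u (x , y) ⊕ 1) ⊕ (n ∸ 1)      ≡⟨ ⊕-⊕-multiple (at u (x , y)) 1 (trans (m+[n∸m]≡n (>-nonZero⁻¹ n)) (sym (*-identityˡ n))) ⟩
    at u (x , y)                      ∎)

  at-down : ∀ u x y → at u (x , y) ≡ at u (x , suc y) ⊕ (n ∸ d)
  at-down u x y = sym (begin
    at u (x , suc y) ⊕ (n ∸ d)        ≡⟨ cong (_⊕ (n ∸ d)) (at-up u x y) ⟩
    (at u (x , y) ⊕ d) ⊕ (n ∸ d)      ≡⟨ ⊕-⊕-multiple (at u (x , y)) 1 (trans (m+[n∸m]≡n (<⇒≤ d<n)) (sym (*-identityˡ n))) ⟩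
    at u (x , y)                      ∎)

  at-step : ∀ u f x y → at u (step f (suc x , suc y)) ≡ at u (suc x , suc y) ⊕ shift f
  at-step u right x y = at-right u (suc x) (suc y)
  at-step u left  x y = at-left u x (suc y)
  at-step u up    x y = at-up u (suc x) (suc y)
  at-step u down  x y = at-down u (suc x) y

  at-at : ∀ u {a b x y x′ y′} → x + a ≡ x′ + 2 → y + b ≡ y′ + 2 → at (at u (a , b)) (x , y) ≡ at u (x′ , y′)
  at-at u {a} {b} {x} {y} {x′} {y′} x+a≡ y+b≡ = begin
    (u ⊕ (k + (a + b * d))) ⊕ (k + (x + y * d))  ≡⟨ ⊕-assoc u _ _ ⟩
    u ⊕ ((k + (a + b * d)) + (k + (x + y * d)))  ≡⟨ cong (u ⊕_) offsets ⟩
    u ⊕ ((k + (x′ + y′ * d)) + (m + k))          ≡⟨ ⊕-assoc u _ _ ⟨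
    at u (x′ , y′) ⊕ (m + k)                     ≡⟨ cong (at u (x′ , y′) ⊕_) (k+[n∸1]k≡kn m) ⟩
    at u (x′ , y′) ⊕ m * n                       ≡⟨ ⊕-multiple (at u (x′ , y′)) m ⟩
    at u (x′ , y′)                               ∎
    where
    m = 2 + 2 * d
    k = (n ∸ 1) * m
    regroupˡ : ∀ k a b x y d → (k + (a + b * d)) + (k + (x + y * d)) ≡ k + k + (x + a) + (y + b) * d
    regroupˡ = solve-∀
    regroupʳ : ∀ k x′ y′ d → k + k + (x′ + 2) + (y′ + 2) * d ≡ (k + (x′ + y′ * d)) + ((2 + 2 * d) + k)
    regroupʳ = solve-∀
    offsets : (k + (a + b * d)) + (k + (x + y * d)) ≡ (k + (x′ + y′ * d)) + (m + k)
    offsets = begin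
      (k + (a + b * d)) + (k + (x + y * d))  ≡⟨ regroupˡ k a b x y d ⟩
      k + k + (x + a) + (y + b) * d          ≡⟨ cong₂ (λ p q → k + k + p + q * d) x+a≡ y+b≡ ⟩
      k + k + (x′ + 2) + (y′ + 2) * d        ≡⟨ regroupʳ k x′ y′ d ⟩
      (k + (x′ + y′ * d)) + (m + k)          ∎

  InN-at⇒ball : ∀ u x y {w} → InN n d (at u (suc x , suc y)) w → ∃ λ z → z ∈ ball (suc x , suc y) × at u z ≡ w
  InN-at⇒ball u x y inN with InN⇒shift inN
  ... | inj₁ w≡c       = (suc x , suc y) , here refl , sym w≡c
  ... | inj₂ (f , c⊕≡) = step f (suc x , suc y)
                        , there (∈-map⁺ (λ f → step f (suc x , suc y)) (∈-directions f))
                        , trans (at-step u f x y) c⊕≡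

  ball⇒InN-at : ∀ u x y {z} → z ∈ ball (suc x , suc y) → InN n d (at u (suc x , suc y)) (at u z)
  ball⇒InN-at u x y (here refl) = inj₁ refl
  ball⇒InN-at u x y (there z∈) with ∈-map⁻ (λ f → step f (suc x , suc y)) {xs = directions} z∈
  ... | f , _ , refl = subst (InN n d (at u (suc x , suc y))) (sym (at-step u f x y)) (shift⇒InN _ f)

  at-neighbour : ∀ u f → at u (step f centre) ≡ u ⊕ shift f
  at-neighbour u f = trans (at-step u f 1 1) (cong (_⊕ shift f) (at-centre u))

  centre≢neighbour : ∀ u f → at u centre ≢ at u (step f centre)
  centre≢neighbour u f eq = ≢⊕shift u f (trans (sym (at-centre u)) (trans eq (at-neighbour u f)))

  neighbours-≢ : ∀ u f g → shift f ≢ shift g → at u (step f centre) ≢ at u (step g centre)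
  neighbours-≢ u f g shifts≢ eq = shifts≢ (⊕-cancelˡ u (shift<n f) (shift<n g)
    (trans (sym (at-neighbour u f)) (trans eq (at-neighbour u g))))

  -- The shifts are ordered 1 < d ≤ n ∸ d < n ∸ 1; only up and down may coincide.
  d≤n∸d : d ≤ n ∸ d
  d≤n∸d = m+n≤o⇒m≤o∸n d d+d≤n

  n∸d<n∸1 : n ∸ d < n ∸ 1
  n∸d<n∸1 = ∸-monoʳ-< 2≤d (<⇒≤ d<n)

  right≢left : 1 ≢ n ∸ 1
  right≢left = <⇒≢ (<-≤-trans 2≤d (≤-trans d≤n∸d (<⇒≤ n∸d<n∸1)))

  right≢up : 1 ≢ d
  right≢up = <⇒≢ 2≤d

  right≢down : 1 ≢ n ∸ d
  right≢down = <⇒≢ (<-≤-trans 2≤d d≤n∸d)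

  left≢up : n ∸ 1 ≢ d
  left≢up = ≢-sym (<⇒≢ (≤-<-trans d≤n∸d n∸d<n∸1))

  left≢down : n ∸ 1 ≢ n ∸ d
  left≢down = ≢-sym (<⇒≢ n∸d<n∸1)

  north≡south⇒wrap-north : ∀ u → at u north ≡ at u south → at u (2 , 4) ≡ at u centre
  north≡south⇒wrap-north u N≡S = begin
    at u (2 , 4)      ≡⟨ at-up u 2 3 ⟩
    at u north ⊕ d    ≡⟨ cong (_⊕ d) N≡S ⟩
    at u south ⊕ d    ≡⟨ at-up u 2 1 ⟨
    at u centre       ∎

  north≡south⇒wrap-south : ∀ u → at u north ≡ at u south → at u (2 , 0) ≡ at u centre
  north≡south⇒wrap-south u N≡S = begin
    at u (2 , 0)            ≡⟨ at-down u 2 0 ⟩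
    at u south ⊕ (n ∸ d)    ≡⟨ cong (_⊕ (n ∸ d)) N≡S ⟨
    at u north ⊕ (n ∸ d)    ≡⟨ at-down u 2 2 ⟨
    at u centre             ∎

  module _ (C : Subset n) where

    view : Fin n → Pattern
    view u c = lookup C (at u c)

    dominated-view : ∀ u x y → (∃ λ w → InI n d C (at u (suc x , suc y)) w) → T (dominatedᵇ (view u) (suc x , suc y))
    dominated-view u x y (w , w∈C , inN) with InN-at⇒ball u x y inN
    ... | z , z∈ , refl = any⁺ (view u) (Any.map (λ z≡ → subst (T ∘ view u) z≡ (T-lookup w∈C)) z∈)

    covers-view : ∀ u x y x′ y′ → T (coversᵇ (view u) (suc x , suc y) (suc x′ , suc y′)) →
                  ∀ {w} → InI n d C (at u (suc x , suc y)) w → InI n d C (at u (suc x′ , suc y′)) w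
    covers-view u x y x′ y′ covers (w∈C , inN) with InN-at⇒ball u x y inN
    ... | z , z∈ , refl = w∈C , ball⇒InN-at u x′ y′ (∈ᵇ⇒∈ z _ z∈ball′)
      where
      z∈ball′ : T (z ∈ᵇ ball (suc x′ , suc y′))
      z∈ball′ = implicationᵇ (All.lookup (all⁺ (λ z → not (view u z) ∨ z ∈ᵇ ball (suc x′ , suc y′))
                                               (ball (suc x , suc y)) covers) z∈)
                             (T-lookup w∈C)

    view-valid : ∀ sep u → Dominating n d C →
      (∀ x y x′ y′ → at u (suc x , suc y) ≢ at u (suc x′ , suc y′) → T (sep (view u) (suc x , suc y) (suc x′ , suc y′))) →
      (at u north ≡ at u south → T (sep (view u) north south)) →
      T (valid sep (view u))
    view-valid sep u dominating separates separatesNS = Equivalence.from T-∧ (all⁻ _ dominated , all⁻ _ separated)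
      where
      dom : ∀ x y → T (dominatedᵇ (view u) (suc x , suc y))
      dom x y = dominated-view u x y (dominating _)
      dominated : All (T ∘ dominatedᵇ (view u)) (ball centre)
      dominated = dom 1 1 ∷ dom 2 1 ∷ dom 0 1 ∷ dom 1 2 ∷ dom 1 0 ∷ []
      separatesNS′ : T (sep (view u) north south)
      separatesNS′ with at u north ≟ᶠ at u south
      ... | yes N≡S = separatesNS N≡S
      ... | no N≢S  = separates 1 2 1 0 N≢S
      separated : All (T ∘ uncurry (sep (view u))) innerPairs
      separated = separates 1 1 2 1 (centre≢neighbour u right) ∷ separates 1 1 0 1 (centre≢neighbour u left)
                ∷ separates 1 1 1 2 (centre≢neighbour u up)    ∷ separates 1 1 1 0 (centre≢neighbour u down)
                ∷ separates 2 1 0 1 (neighbours-≢ u right left right≢left)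
                ∷ separates 2 1 1 2 (neighbours-≢ u right up right≢up)
                ∷ separates 2 1 1 0 (neighbours-≢ u right down right≢down)
                ∷ separates 0 1 1 2 (neighbours-≢ u left up left≢up)
                ∷ separates 0 1 1 0 (neighbours-≢ u left down left≢down)
                ∷ separatesNS′ ∷ []

    covers⇒SameI : ∀ u x y x′ y′ → T (coversᵇ (view u) (suc x , suc y) (suc x′ , suc y′)) →
                   T (coversᵇ (view u) (suc x′ , suc y′) (suc x , suc y)) →
                   SameI n d C (at u (suc x , suc y)) (at u (suc x′ , suc y′))
    covers⇒SameI u x y x′ y′ covers covers′ _ = mk⇔ (covers-view u x y x′ y′ covers) (covers-view u x′ y′ x y covers′)

    ¬covers-north-south : Dominating n d C → ∀ u → at u north ≡ at u south → ¬ T (coversᵇ (view u) north south)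
    ¬covers-north-south dominating u N≡S =
      north-wrap (view u) (cong (lookup C) (north≡south⇒wrap-north u N≡S)) (dominated-view u 1 2 (dominating _))

    ¬covers-south-north : Dominating n d C → ∀ u → at u north ≡ at u south → ¬ T (coversᵇ (view u) south north)
    ¬covers-south-north dominating u N≡S =
      south-wrap (view u) (cong (lookup C) (north≡south⇒wrap-south u N≡S)) (dominated-view u 1 0 (dominating _))

    identifying-valid : Identifying n d C → ∀ u → T (valid separatesᴵᴰ (view u))
    identifying-valid (_ , dominating , identifies) u = view-valid separatesᴵᴰ u dominating separates
      (separatesᴵᴰ-introˡ (view u) north south ∘ ¬covers-north-south dominating u)
      where
      separates : ∀ x y x′ y′ → at u (suc x , suc y) ≢ at u (suc x′ , suc y′) →
                  T (separatesᴵᴰ (view u) (suc x , suc y) (suc x′ , suc y′))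
      separates x y x′ y′ c≢c′ = separatesᴵᴰ-intro (view u) (suc x , suc y) (suc x′ , suc y′) λ covers covers′ →
        identifies _ _ c≢c′ (covers⇒SameI u x y x′ y′ covers covers′)

    locatingDominating-valid : LocatingDominating n d C → ∀ u → T (valid separatesᴸᴰ (view u))
    locatingDominating-valid (_ , dominating , locates) u = view-valid separatesᴸᴰ u dominating separates
      (λ N≡S → separatesᴸᴰ-intro (view u) north south λ _ _ →
        separatesᴵᴰ-introˡ (view u) north south (¬covers-north-south dominating u N≡S))
      where
      separates : ∀ x y x′ y′ → at u (suc x , suc y) ≢ at u (suc x′ , suc y′) →
                  T (separatesᴸᴰ (view u) (suc x , suc y) (suc x′ , suc y′))
      separates x y x′ y′ c≢c′ = separatesᴸᴰ-intro (view u) (suc x , suc y) (suc x′ , suc y′) λ c∉C c′∉C →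
        separatesᴵᴰ-intro (view u) (suc x , suc y) (suc x′ , suc y′) λ covers covers′ →
          locates _ _ (lookup≡false⇒∉ c∉C) (lookup≡false⇒∉ c′∉C) c≢c′ (covers⇒SameI u x y x′ y′ covers covers′)

    selfIdentifying⇒dominating : SelfIdentifying n d C → Dominating n d C
    selfIdentifying⇒dominating (_ , distinguishes) v with distinguishes v (v ⊕ 1) (≢⊕shift v right)
    ... | w , inI , _ = w , inI

    selfIdentifying-valid : SelfIdentifying n d C → ∀ u → T (valid separatesˢᴵᴰ (view u))
    selfIdentifying-valid sid@(_ , distinguishes) u = view-valid separatesˢᴵᴰ u dominating separates
      (λ N≡S → separatesˢᴵᴰ-intro (view u) north south
        (¬covers-north-south dominating u N≡S) (¬covers-south-north dominating u N≡S))
      where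
      dominating = selfIdentifying⇒dominating sid
      ¬covers : ∀ x y x′ y′ → at u (suc x , suc y) ≢ at u (suc x′ , suc y′) →
                ¬ T (coversᵇ (view u) (suc x , suc y) (suc x′ , suc y′))
      ¬covers x y x′ y′ c≢c′ covers = let _ , inI , ∉I′ = distinguishes _ _ c≢c′ in ∉I′ (covers-view u x y x′ y′ covers inI)
      separates : ∀ x y x′ y′ → at u (suc x , suc y) ≢ at u (suc x′ , suc y′) →
                  T (separatesˢᴵᴰ (view u) (suc x , suc y) (suc x′ , suc y′))
      separates x y x′ y′ c≢c′ = separatesˢᴵᴰ-intro (view u) (suc x , suc y) (suc x′ , suc y′)
        (¬covers x y x′ y′ c≢c′) (¬covers x′ y′ x y (c≢c′ ∘ sym))

    read-view-at : ∀ u p {k} {cs cs′ : Vec Cell k} → Pointwise (Translates p) cs cs′ →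
                   read (view (at u p)) cs ≡ read (view u) cs′
    read-view-at u p [] = refl
    read-view-at u (a , b) {cs = (x , y) ∷ _} {(x′ , y′) ∷ _} ((x+a≡ , y+b≡) ∷ translates) =
      cong₂ _∷_ (cong (lookup C) (at-at u {a} {b} {x} {y} {x′} {y′} x+a≡ y+b≡)) (read-view-at u (a , b) translates)

    sum-inflow≡sum-outflow : ∀ ρ → sum (λ u → inflow ρ (view u)) ≡ sum (λ u → outflow ρ (view u))
    sum-inflow≡sum-outflow ρ = begin
      sum (λ u → sum λ i → ρ (read (view u) (domino (o i) (predecessor (o i)))))
        ≡⟨ sum-cong-≗ (λ u → sum-cong-≗ λ i → cong ρ (read-view-at u _ (domino-predecessor i))) ⟨
      sum (λ u → sum λ i → ρ (read (view (at u (predecessor (o i)))) (domino (o i) centre)))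
        ≡⟨ ∑-comm (λ u i → ρ (read (view (at u (predecessor (o i)))) (domino (o i) centre))) ⟩
      sum (λ i → sum λ u → ρ (read (view (at u (predecessor (o i)))) (domino (o i) centre)))
        ≡⟨ sum-cong-≗ (λ i → sum-⊕ (λ u → ρ (read (view u) (domino (o i) centre))) (offset (predecessor (o i)))) ⟩
      sum (λ i → sum λ u → ρ (read (view u) (domino (o i) centre)))
        ≡⟨ ∑-comm (λ u i → ρ (read (view u) (domino (o i) centre))) ⟨
      sum (λ u → outflow ρ (view u)) ∎
      where o = Vec.lookup orientations

    discharging : ∀ sep ρ A B → (∀ p → T (valid sep p) → A + outflow ρ p ≤ charge B p + inflow ρ p) →
                  (∀ u → T (valid sep (view u))) → n * A ≤ B * ∣ C ∣
    discharging sep ρ A B balanced valid-view = +-cancelʳ-≤ Σout (n * A) (B * ∣ C ∣)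
      (subst₂ _≤_ Σbefore Σafter (sum-mono-≤ λ u → balanced (view u) (valid-view u)))
      where
      Σout = sum λ u → outflow ρ (view u)
      Σbefore : sum (λ u → A + outflow ρ (view u)) ≡ n * A + Σout
      Σbefore = begin
        sum (λ u → A + outflow ρ (view u))  ≡⟨ ∑-distrib-+ {n} (λ _ → A) (λ u → outflow ρ (view u)) ⟩
        sum {n} (λ _ → A) + Σout            ≡⟨ cong (_+ Σout) (sum-const {n} A) ⟩
        n * A + Σout                        ∎
      Σafter : sum (λ u → charge B (view u) + inflow ρ (view u)) ≡ B * ∣ C ∣ + Σout
      Σafter = begin
        sum (λ u → charge B (view u) + inflow ρ (view u))         ≡⟨ ∑-distrib-+ (λ u → charge B (view u)) (λ u → inflow ρ (view u)) ⟩
        sum (λ u → charge B (view u)) + sum (λ u → inflow ρ (view u))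
          ≡⟨ cong₂ _+_ (sum-cong-≗ λ u → cong (λ v → if lookup C v then B else 0) (at-centre u)) (sum-inflow≡sum-outflow ρ) ⟩
        sum (λ u → if lookup C u then B else 0) + Σout           ≡⟨ cong (_+ Σout) (sum-if C B) ⟩
        B * ∣ C ∣ + Σout                                          ∎

    identifying-bound : Identifying n d C → 7 * n ≤ ∣ C ∣ * 20
    identifying-bound id = *-cancel-common-≤ 8 7 20 n ∣ C ∣
      (discharging separatesᴵᴰ ρᴵᴰ 56 160 balancedᴵᴰ (identifying-valid id))

    locatingDominating-bound : LocatingDominating n d C → 3 * n ≤ ∣ C ∣ * 10
    locatingDominating-bound ld = *-cancel-common-≤ 8 3 10 n ∣ C ∣
      (discharging separatesᴸᴰ ρᴸᴰ 24 80 balancedᴸᴰ (locatingDominating-valid ld))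

    selfIdentifying-bound : SelfIdentifying n d C → n ≤ ∣ C ∣ * 2
    selfIdentifying-bound sid = subst (_≤ ∣ C ∣ * 2) (*-identityˡ n) (*-cancel-common-≤ 8 1 2 n ∣ C ∣
      (discharging separatesˢᴵᴰ ρˢᴵᴰ 8 16 balancedˢᴵᴰ (selfIdentifying-valid sid)))

corollary1 : (n d : ℕ) .{{_ : NonZero n}} → 2 ≤ d → 2 * d ≤ n →
    (∀ (C : Subset n) → LocatingDominating n d C → ⌈ 3 * n / 10 ⌉ ≤ ∣ C ∣)
    × (∀ (C : Subset n) → Identifying n d C → ⌈ 7 * n / 20 ⌉ ≤ ∣ C ∣)
    × (∀ (C : Subset n) → SelfIdentifying n d C → ⌈ n / 2 ⌉ ≤ ∣ C ∣)
corollary1 n d 2≤d 2d≤n =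
    (λ C → ⌈/⌉-≤ (3 * n) 10 ∣ C ∣ ∘ locatingDominating-bound C)
  , (λ C → ⌈/⌉-≤ (7 * n) 20 ∣ C ∣ ∘ identifying-bound C)
  , (λ C → ⌈/⌉-≤ n 2 ∣ C ∣ ∘ selfIdentifying-bound C)
  where open Circulant n d 2≤d 2d≤n
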